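{- Let $m$ be a positive integer and $n$ a non-negative integer. Then for every $x\in\mathbb{Z}/m\mathbb{Z}$, $$\frac{1}{m^n}\sum_{\nabla}\mu_\nabla(x)=\frac{1}{m}\binom{n+1}{2},$$ where the sum ranges over the $m^n$ triangles $\nabla=\nabla S$ of size $n$, $S$ running over all $n$-tuples of elements of $\mathbb{Z}/m\mathbb{Z}$.
   Context: For an $n$-tuple $S=(u_0,\dots,u_{n-1})$ over $\mathbb{Z}/m\mathbb{Z}$, $\nabla S$ is the family $(a_{i,j})_{i,j\ge0,\,i+j<n}$ with $a_{0,j}=u_j$ and $a_{i,j}=-a_{i-1,j}-a_{i-1,j+1}$ for $i\ge1$. $\mu_\nabla(x)$ is the number of entries of $\nabla$ equal to $x$. -}

module Defs where

open import Data.Nat using (ℕ; zero; suc; _+_; _*_; _∸_; NonZero)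
open import Data.Nat.DivMod using (_mod_)
open import Data.Fin using (Fin; toℕ; _≟_)
open import Data.List using (List; []; _∷_; map; concatMap; length; filter; allFin)
open import Data.Nat.ListAction using (sum)
open import Data.Vec using (Vec; toList)
import Data.Vec as V

-- ℤ/mℤ is represented by Fin m (residues 0 … m-1), for m > 0.
-- Negated sum in ℤ/mℤ:  negSum a b = -(a + b) mod m.
negSum : (m : ℕ) .{{_ : NonZero m}} → Fin m → Fin m → Fin m
negSum m a b = ((m + m) ∸ (toℕ a + toℕ b)) mod m

nextRow : (m : ℕ) .{{_ : NonZero m}} → List (Fin m) → List (Fin m)
nextRow m [] = []
nextRow m (a ∷ []) = []
nextRow m (a ∷ b ∷ as) = negSum m a b ∷ nextRow m (b ∷ as)

rowsFrom : (m : ℕ) .{{_ : NonZero m}} → ℕ → List (Fin m) → List (List (Fin m))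
rowsFrom m zero r = []
rowsFrom m (suc k) r = r ∷ rowsFrom m k (nextRow m r)

-- The triangle ∇S of a tuple S of size n: rows i = 0 … n-1, row i = (a_{i,j})_{j < n-i}.
triangle : (m : ℕ) .{{_ : NonZero m}} → (n : ℕ) → Vec (Fin m) n → List (List (Fin m))
triangle m n S = rowsFrom m n (toList S)

count : {m : ℕ} → Fin m → List (Fin m) → ℕ
count x l = length (filter (x ≟_) l)

mult : {m : ℕ} → Fin m → List (List (Fin m)) → ℕ
mult x rows = sum (map (count x) rows)

tuples : (m n : ℕ) → List (Vec (Fin m) n)
tuples m zero = V.[] ∷ []
tuples m (suc n) = concatMap (λ a → map (a V.∷_) (tuples m n)) (allFin m)

totalMult : (m : ℕ) .{{_ : NonZero m}} → (n : ℕ) → Fin m → ℕ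
totalMult m n x = sum (map (λ S → mult x (triangle m n S)) (tuples m n))

{-# OPTIONS --safe #-}
module Submission where

-- Write a tuple of length n + 1 as a ∷ S.  The triangle of a ∷ S is the triangle of S plus
-- its left edge e₀ = a, e₁, …, eₙ with e_{i+1} = −(eᵢ + bᵢ), bᵢ the first entry of row i of
-- the triangle of S.  Each map z ↦ −(z + b) is an involution of ℤ/mℤ, so every eᵢ is a
-- permutation of a, and as a ranges over ℤ/mℤ each eᵢ equals x exactly once.  Hence
-- Σ_{|S| = n+1} μ(x) = (n + 1) mⁿ + m Σ_{|S| = n} μ(x), and Pascal's rule finishes the
-- induction on n.

open import Defs
open import Data.Nat using (ℕ; zero; suc; pred; _+_; _*_; _∸_; _^_; _≤_; NonZero)
open import Data.Nat.Properties using (+-mono-≤; <⇒≤; m∸n+n≡m; m+n∸n≡m; *-zeroʳ; *-assoc; +-identityʳ; suc-injective; *-distribˡ-+; +-commutativeSemigroup)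
open import Data.Nat.DivMod using (_%_; _/_; m≡m%n+[m/n]*n; [m+kn]%n≡m%n; m<n⇒m%n≡m; m%n<n)
open import Data.Nat.Combinatorics using (_C_; nCk+nC[k+1]≡[n+1]C[k+1]; nC1≡n)
open import Data.Nat.ListAction using (sum)
open import Data.Nat.ListAction.Properties using (sum-++)
open import Data.Nat.Solver using (module +-*-Solver)
open import Algebra.Properties.CommutativeSemigroup +-commutativeSemigroup using () renaming (interchange to +-interchange)
open import Data.Fin using (Fin; toℕ; _≟_)
import Data.Fin as F
open import Data.Fin.Properties using (toℕ-fromℕ<; toℕ-injective; toℕ<n)
open import Data.Fin.Permutation using (Permutation′; permutation; _⟨$⟩ʳ_; _⟨$⟩ˡ_; inverseˡ; inverseʳ; _∘ₚ_)
import Data.Fin.Permutation as Perm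
open import Data.Bool using (true; false; if_then_else_)
open import Data.List using (List; []; _∷_; _++_; map; concatMap; length; allFin; tabulate)
open import Data.List.Properties using (map-++; map-∘; map-tabulate)
open import Data.Vec using (Vec; toList)
import Data.Vec as V
open import Data.Vec.Properties using (length-toList)
open import Function using (_∘_)
open import Relation.Nullary using (does; yes; no; contradiction)
open import Relation.Binary.PropositionalEquality using (_≡_; refl; sym; trans; cong; cong₂; module ≡-Reasoning)

private variable
  A B : Set

∑ : (A → ℕ) → List A → ℕ
∑ f l = sum (map f l)

infixr 5 ∑
syntax ∑ (λ a → e) l = ∑[ a ∈ l ] e

∑-cong : {f g : A → ℕ} (l : List A) → (∀ a → f a ≡ g a) → ∑ f l ≡ ∑ g l
∑-cong []      f≗g = refl
∑-cong (a ∷ l) f≗g = cong₂ _+_ (f≗g a) (∑-cong l f≗g)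

∑-distrib-+ : (f g : A → ℕ) (l : List A) → ∑[ a ∈ l ] (f a + g a) ≡ ∑ f l + ∑ g l
∑-distrib-+ f g []      = refl
∑-distrib-+ f g (a ∷ l) = trans (cong (f a + g a +_) (∑-distrib-+ f g l)) (+-interchange (f a) (g a) (∑ f l) (∑ g l))

*-distribˡ-∑ : (c : ℕ) (f : A → ℕ) (l : List A) → c * ∑ f l ≡ ∑[ a ∈ l ] c * f a
*-distribˡ-∑ c f []      = *-zeroʳ c
*-distribˡ-∑ c f (a ∷ l) = trans (*-distribˡ-+ c (f a) (∑ f l)) (cong (c * f a +_) (*-distribˡ-∑ c f l))

∑-++ : (f : A → ℕ) (l l′ : List A) → ∑ f (l ++ l′) ≡ ∑ f l + ∑ f l′
∑-++ f l l′ = trans (cong sum (map-++ f l l′)) (sum-++ (map f l) (map f l′))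

∑-map : (f : B → ℕ) (h : A → B) (l : List A) → ∑ f (map h l) ≡ ∑ (f ∘ h) l
∑-map f h l = cong sum (sym (map-∘ l))

∑-concatMap : (f : B → ℕ) (g : A → List B) (l : List A) →
  ∑ f (concatMap g l) ≡ ∑[ a ∈ l ] ∑ f (g a)
∑-concatMap f g []      = refl
∑-concatMap f g (a ∷ l) = trans (∑-++ f (g a) (concatMap g l)) (cong (∑ f (g a) +_) (∑-concatMap f g l))

∑-comm : (f : A → B → ℕ) (l : List A) (l′ : List B) →
  ∑[ a ∈ l ] ∑[ b ∈ l′ ] f a b ≡ ∑[ b ∈ l′ ] ∑[ a ∈ l ] f a b
∑-comm f []      l′ = sym (∑-zero l′)
  where
  ∑-zero : (l′ : List B) → ∑[ _ ∈ l′ ] 0 ≡ 0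
  ∑-zero []       = refl
  ∑-zero (_ ∷ l′) = ∑-zero l′
∑-comm f (a ∷ l) l′ = trans (cong (∑ (f a) l′ +_) (∑-comm f l l′))
  (sym (∑-distrib-+ (f a) (λ b → ∑[ a′ ∈ l ] f a′ b) l′))

δ : {n : ℕ} → Fin n → Fin n → ℕ
δ x y = if does (x ≟ y) then 1 else 0

count-∷ : {n : ℕ} (x y : Fin n) (l : List (Fin n)) → count x (y ∷ l) ≡ δ x y + count x l
count-∷ x y l with does (x ≟ y)
... | true  = refl
... | false = refl

∑-tabulate : {n : ℕ} (f : A → ℕ) (g : Fin n → A) → ∑ f (tabulate g) ≡ ∑ (f ∘ g) (allFin n)
∑-tabulate f g = cong sum (trans (map-tabulate g f) (sym (map-tabulate (λ i → i) (f ∘ g))))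

∑-allFin-const : (n c : ℕ) → ∑[ _ ∈ allFin n ] c ≡ n * c
∑-allFin-const zero    c = refl
∑-allFin-const (suc n) c = cong (c +_) (trans (∑-tabulate {n = n} (λ _ → c) F.suc) (∑-allFin-const n c))

∑-δ-allFin : {n : ℕ} (y : Fin n) → ∑ (δ y) (allFin n) ≡ 1
∑-δ-allFin {suc n} F.zero    = cong suc (trans (∑-tabulate {n = n} (δ F.zero) F.suc)
                                               (trans (∑-allFin-const n 0) (*-zeroʳ n)))
∑-δ-allFin {suc n} (F.suc y) = trans (∑-tabulate {n = n} (δ (F.suc y)) F.suc) (∑-δ-allFin y)

δ-permute : {n : ℕ} (π : Permutation′ n) (x a : Fin n) → δ x (π ⟨$⟩ʳ a) ≡ δ (π ⟨$⟩ˡ x) a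
δ-permute π x a with x ≟ π ⟨$⟩ʳ a | π ⟨$⟩ˡ x ≟ a
... | yes _    | yes _      = refl
... | no  _    | no  _      = refl
... | yes refl | no  π⁻¹x≢a = contradiction (inverseˡ π) π⁻¹x≢a
... | no  x≢πa | yes refl   = contradiction (sym (inverseʳ π)) x≢πa

∑-δ-permute : {n : ℕ} (π : Permutation′ n) (x : Fin n) → ∑[ a ∈ allFin n ] δ x (π ⟨$⟩ʳ a) ≡ 1
∑-δ-permute π x = trans (∑-cong (allFin _) (δ-permute π x)) (∑-δ-allFin (π ⟨$⟩ˡ x))

∑-tuples-suc : (m n : ℕ) (f : Vec (Fin m) (suc n) → ℕ) →
  ∑ f (tuples m (suc n)) ≡ ∑[ a ∈ allFin m ] ∑[ S ∈ tuples m n ] f (a V.∷ S)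
∑-tuples-suc m n f = trans (∑-concatMap f (λ a → map (a V.∷_) (tuples m n)) (allFin m))
  (∑-cong (allFin m) (λ a → ∑-map f (a V.∷_) (tuples m n)))

∑-tuples-const : (m n c : ℕ) → ∑[ _ ∈ tuples m n ] c ≡ m ^ n * c
∑-tuples-const m zero    c = refl
∑-tuples-const m (suc n) c = begin
  ∑[ _ ∈ tuples m (suc n) ] c                   ≡⟨ ∑-tuples-suc m n (λ _ → c) ⟩
  ∑[ _ ∈ allFin m ] ∑[ _ ∈ tuples m n ] c       ≡⟨ ∑-cong (allFin m) (λ _ → ∑-tuples-const m n c) ⟩
  ∑[ _ ∈ allFin m ] m ^ n * c                   ≡⟨ ∑-allFin-const m (m ^ n * c) ⟩
  m * (m ^ n * c)                               ≡⟨ sym (*-assoc m (m ^ n) c) ⟩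
  m ^ suc n * c                                 ∎
  where open ≡-Reasoning

∸-%-involutive : ∀ d .{{_ : NonZero d}} N a c → a + c ≤ N →
  (N ∸ ((N ∸ (a + c)) % d + c)) % d ≡ a % d
∸-%-involutive d N a c a+c≤N = begin
  (N ∸ (r + c)) % d                  ≡⟨ cong (λ z → (z ∸ (r + c)) % d) N-split ⟩
  ((a + q * d) + (r + c) ∸ (r + c)) % d ≡⟨ cong (_% d) (m+n∸n≡m (a + q * d) (r + c)) ⟩
  (a + q * d) % d                    ≡⟨ [m+kn]%n≡m%n a q d ⟩
  a % d                              ∎
  where
  open ≡-Reasoning
  open +-*-Solver
  t = N ∸ (a + c)
  r = t % d
  q = t / d
  N-split : N ≡ (a + q * d) + (r + c)
  N-split = begin
    N                          ≡⟨ sym (m∸n+n≡m a+c≤N) ⟩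
    t + (a + c)                ≡⟨ cong (_+ (a + c)) (m≡m%n+[m/n]*n t d) ⟩
    (r + q * d) + (a + c)      ≡⟨ solve 4 (λ r qd a c → (r :+ qd) :+ (a :+ c) := (a :+ qd) :+ (r :+ c))
                                        refl r (q * d) a c ⟩
    (a + q * d) + (r + c)      ∎

module _ (m : ℕ) .{{_ : NonZero m}} where

  negSum-involutive : (b a : Fin m) → negSum m (negSum m a b) b ≡ a
  negSum-involutive b a = toℕ-injective (begin
    toℕ (negSum m (negSum m a b) b)                          ≡⟨ toℕ-negSum (negSum m a b) b ⟩
    (m + m ∸ (toℕ (negSum m a b) + toℕ b)) % m              ≡⟨ cong (λ r → (m + m ∸ (r + toℕ b)) % m) (toℕ-negSum a b) ⟩
    (m + m ∸ ((m + m ∸ (toℕ a + toℕ b)) % m + toℕ b)) % m ≡⟨ ∸-%-involutive m (m + m) (toℕ a) (toℕ b) a+b≤m+m ⟩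
    toℕ a % m                                                ≡⟨ m<n⇒m%n≡m (toℕ<n a) ⟩
    toℕ a                                                    ∎)
    where
    open ≡-Reasoning
    toℕ-negSum : (a b : Fin m) → toℕ (negSum m a b) ≡ (m + m ∸ (toℕ a + toℕ b)) % m
    toℕ-negSum a b = toℕ-fromℕ< (m%n<n (m + m ∸ (toℕ a + toℕ b)) m)
    a+b≤m+m : toℕ a + toℕ b ≤ m + m
    a+b≤m+m = +-mono-≤ (<⇒≤ (toℕ<n a)) (<⇒≤ (toℕ<n b))

  negSum-permutation : Fin m → Permutation′ m
  negSum-permutation b = permutation (λ a → negSum m a b) (λ a → negSum m a b)
    (negSum-involutive b) (negSum-involutive b)

  length-nextRow : (l : List (Fin m)) → length (nextRow m l) ≡ pred (length l)
  length-nextRow []          = refl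
  length-nextRow (_ ∷ [])    = refl
  length-nextRow (_ ∷ b ∷ l) = cong suc (length-nextRow (b ∷ l))

  module _ (x : Fin m) where

    ∑-mult-rowsFrom : (π : Permutation′ m) (k : ℕ) (s : List (Fin m)) → length s ≡ k →
      ∑[ a ∈ allFin m ] mult x (rowsFrom m (suc k) ((π ⟨$⟩ʳ a) ∷ s)) ≡ suc k + m * mult x (rowsFrom m k s)
    ∑-mult-rowsFrom π zero [] refl = begin
      ∑[ a ∈ allFin m ] (count x ((π ⟨$⟩ʳ a) ∷ []) + 0)
        ≡⟨ ∑-cong (allFin m) (λ a → cong (_+ 0) (count-∷ x (π ⟨$⟩ʳ a) [])) ⟩
      ∑[ a ∈ allFin m ] (δ x (π ⟨$⟩ʳ a) + 0 + 0)
        ≡⟨ ∑-cong (allFin m) (λ a → trans (+-identityʳ _) (+-identityʳ _)) ⟩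
      ∑[ a ∈ allFin m ] δ x (π ⟨$⟩ʳ a)
        ≡⟨ ∑-δ-permute π x ⟩
      1
        ≡⟨ cong suc (sym (*-zeroʳ m)) ⟩
      1 + m * 0 ∎
      where open ≡-Reasoning
    ∑-mult-rowsFrom π (suc k) (b ∷ s) |s|≡1+k = begin
      ∑[ a ∈ allFin m ] (count x ((π ⟨$⟩ʳ a) ∷ b ∷ s) + M a)
        ≡⟨ ∑-cong (allFin m) (λ a → cong (_+ M a) (count-∷ x (π ⟨$⟩ʳ a) (b ∷ s))) ⟩
      ∑[ a ∈ allFin m ] ((δ x (π ⟨$⟩ʳ a) + c) + M a)
        ≡⟨ ∑-distrib-+ (λ a → δ x (π ⟨$⟩ʳ a) + c) M (allFin m) ⟩
      (∑[ a ∈ allFin m ] δ x (π ⟨$⟩ʳ a) + c) + ∑ M (allFin m)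
        ≡⟨ cong (_+ ∑ M (allFin m)) (∑-distrib-+ (λ a → δ x (π ⟨$⟩ʳ a)) (λ _ → c) (allFin m)) ⟩
      ((∑[ a ∈ allFin m ] δ x (π ⟨$⟩ʳ a)) + (∑[ _ ∈ allFin m ] c)) + ∑ M (allFin m)
        ≡⟨ cong₂ _+_ (cong₂ _+_ (∑-δ-permute π x) (∑-allFin-const m c))
                     (∑-mult-rowsFrom (π ∘ₚ negSum-permutation b) k s′ |s′|≡k) ⟩
      (1 + m * c) + (suc k + m * r)
        ≡⟨ solve 4 (λ m k c r → (con 1 :+ m :* c) :+ (con 1 :+ k :+ m :* r) := con 2 :+ k :+ m :* (c :+ r))
                 refl m k c r ⟩
      suc (suc k) + m * (c + r) ∎
      where
      open ≡-Reasoning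
      open +-*-Solver
      s′ = nextRow m (b ∷ s)
      c = count x (b ∷ s)
      r = mult x (rowsFrom m k s′)
      M : Fin m → ℕ
      M a = mult x (rowsFrom m (suc k) (negSum m (π ⟨$⟩ʳ a) b ∷ s′))
      |s′|≡k : length s′ ≡ k
      |s′|≡k = trans (length-nextRow (b ∷ s)) (suc-injective |s|≡1+k)

    totalMult-suc : (n : ℕ) → totalMult m (suc n) x ≡ m ^ n * suc n + m * totalMult m n x
    totalMult-suc n = begin
      totalMult m (suc n) x
        ≡⟨ ∑-tuples-suc m n (λ S → mult x (triangle m (suc n) S)) ⟩
      ∑[ a ∈ allFin m ] ∑[ S ∈ tuples m n ] mult x (rowsFrom m (suc n) (a ∷ toList S))
        ≡⟨ ∑-comm (λ a S → mult x (rowsFrom m (suc n) (a ∷ toList S))) (allFin m) (tuples m n) ⟩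
      ∑[ S ∈ tuples m n ] ∑[ a ∈ allFin m ] mult x (rowsFrom m (suc n) (a ∷ toList S))
        ≡⟨ ∑-cong (tuples m n) (λ S → ∑-mult-rowsFrom Perm.id n (toList S) (length-toList S)) ⟩
      ∑[ S ∈ tuples m n ] (suc n + m * mult x (triangle m n S))
        ≡⟨ ∑-distrib-+ (λ _ → suc n) (λ S → m * mult x (triangle m n S)) (tuples m n) ⟩
      (∑[ _ ∈ tuples m n ] suc n) + (∑[ S ∈ tuples m n ] m * mult x (triangle m n S))
        ≡⟨ cong₂ _+_ (∑-tuples-const m n (suc n))
                     (sym (*-distribˡ-∑ m (λ S → mult x (triangle m n S)) (tuples m n))) ⟩
      m ^ n * suc n + m * totalMult m n x ∎
      where open ≡-Reasoning

n+nC2≡[1+n]C2 : (n : ℕ) → n + n C 2 ≡ suc n C 2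
n+nC2≡[1+n]C2 n = trans (cong (_+ n C 2) (sym (nC1≡n n))) (nCk+nC[k+1]≡[n+1]C[k+1] n 1)

proposition3 : (m : ℕ) .{{_ : NonZero m}} (n : ℕ) (x : Fin m) →
    m * totalMult m n x ≡ (m ^ n) * (suc n C 2)
proposition3 m zero    x = *-zeroʳ m
proposition3 m (suc n) x = begin
  m * totalMult m (suc n) x                       ≡⟨ cong (m *_) (totalMult-suc m x n) ⟩
  m * (m ^ n * suc n + m * totalMult m n x)       ≡⟨ cong (λ t → m * (m ^ n * suc n + t)) (proposition3 m n x) ⟩
  m * (m ^ n * suc n + m ^ n * (suc n C 2))       ≡⟨ cong (m *_) (sym (*-distribˡ-+ (m ^ n) (suc n) (suc n C 2))) ⟩
  m * (m ^ n * (suc n + suc n C 2))               ≡⟨ sym (*-assoc m (m ^ n) _) ⟩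
  m ^ suc n * (suc n + suc n C 2)                 ≡⟨ cong (m ^ suc n *_) (n+nC2≡[1+n]C2 (suc n)) ⟩
  m ^ suc n * (suc (suc n) C 2)                   ∎
  where open ≡-Reasoning
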